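{- Let $k\ge 2$. For every integer $n$, $Q_n^{(k)}=2H_{n-1}^{(k)}-H_n^{(k)}$, where $Q_n^{(k)}=L_{ -n}^{(k)}$ and $H_n^{(k)}=F_{ -n}^{(k)}$.
   Context: For an integer $k\ge 2$, the $k$-generalized Lucas sequence is defined by $L_0^{(k)}=2$, $L_1^{(k)}=1$, $L_n^{(k)}=0$ for $-(k-2)\le n\le -1$, and $L_n^{(k)}=\sum_{j=1}^{k}L_{n-j}^{(k)}$ for $n\ge 2$. The $k$-generalized Fibonacci sequence is defined by $F_1^{(k)}=1$, $F_n^{(k)}=0$ for $-(k-2)\le n\le 0$, and $F_n^{(k)}=\sum_{j=1}^{k}F_{n-j}^{(k)}$ for $n\ge 2$. Both sequences are extended to all negative indices by reading the recurrence backwards: $X_{n-k}=X_n-X_{n-1}-\cdots-X_{n-(k-1)}$ for all integers $n$. -}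

module Defs where

open import Data.Nat using (ℕ; zero; suc; _∸_)
open import Data.Integer using (ℤ; +_; -[1+_]; _+_; _-_; -_; 0ℤ; 1ℤ)
open import Data.List using (List; []; _∷_; _++_; [_]; reverse; replicate; foldr)
open import Data.Maybe using (Maybe; just; nothing)

sumℤ : List ℤ → ℤ
sumℤ = foldr _+_ 0ℤ

-- A window is the list (X_{m-k+1}, ..., X_m) of k consecutive terms, oldest first.

fwd : List ℤ → List ℤ
fwd []       = []
fwd (x ∷ xs) = xs ++ [ sumℤ (x ∷ xs) ]

-- backward step: window ending at m  ↦  window ending at m-1,
-- using X_{m-k} = X_m - X_{m-1} - ... - X_{m-k+1}
bwdRev : List ℤ → List ℤ
bwdRev []         = []
bwdRev (xm ∷ rest) = (xm - sumℤ rest) ∷ reverse rest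

bwd : List ℤ → List ℤ
bwd w = bwdRev (reverse w)

iter : (List ℤ → List ℤ) → ℕ → List ℤ → List ℤ
iter f zero    w = w
iter f (suc n) w = f (iter f n w)

-- window ending at index 1 + j, starting from the base window ending at index 1
windowAt : List ℤ → ℤ → List ℤ
windowAt w (+ n)     = iter fwd n w
windowAt w -[1+ n ]  = iter bwd (suc n) w

lastℤ : List ℤ → ℤ
lastℤ w with Data.List.last w
... | just x  = x
... | nothing = 0ℤ

-- the term X_m of the sequence whose base window (X_{-(k-2)}, ..., X_1) is w
seqAt : List ℤ → ℤ → ℤ
seqAt w m = lastℤ (windowAt w (m - 1ℤ))

-- base windows (X_{-(k-2)}, ..., X_0, X_1) for k ≥ 2
lucasInit : ℕ → List ℤ
lucasInit k = replicate (k ∸ 2) 0ℤ ++ (+ 2 ∷ 1ℤ ∷ [])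

fibInit : ℕ → List ℤ
fibInit k = replicate (k ∸ 1) 0ℤ ++ [ 1ℤ ]

L : ℕ → ℤ → ℤ
L k = seqAt (lucasInit k)

F : ℕ → ℤ → ℤ
F k = seqAt (fibInit k)

Q : ℕ → ℤ → ℤ
Q k n = L k (- n)

H : ℕ → ℤ → ℤ
H k n = F k (- n)

{-# OPTIONS --safe #-}
-- Both steps of the recurrence, forwards (append the sum of the window) and
-- backwards (X_{m-k} = X_m - X_{m-1} - ... - X_{m-k+1}), are linear maps on
-- windows. Hence if the Lucas base window is the combination 2 u' - u of the
-- Fibonacci base window u and its successor u', the same holds for all later
-- and earlier windows, i.e. L_m = 2 F_{m+1} - F_m for every m ∈ ℤ; put m = -n.
module Submission where

open import Defs
open import Data.Nat using (ℕ; _≤_; zero; suc; s≤s)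
open import Data.Integer using (ℤ; +_; -[1+_]; _-_; _*_; _+_; -_; 1ℤ; 0ℤ; -1ℤ)
open import Data.Integer.Properties using (+-0-commutativeMonoid; +-0-abelianGroup; +-assoc; -1*i≡-i)
open import Algebra.Properties.AbelianGroup +-0-abelianGroup using (//-rightDividesʳ)
open import Data.Integer.Tactic.RingSolver using (solve-∀)
open import Data.List using (List; []; _∷_; _++_; [_]; reverse; replicate)
open import Data.List.Properties using (unfold-reverse; reverse-++; reverse-involutive)
open import Data.List.Relation.Binary.Permutation.Propositional using (↭⇒↭ₛ)
open import Data.List.Relation.Binary.Permutation.Propositional.Properties using (↭-reverse)
open import Data.List.Relation.Binary.Permutation.Setoid.Properties using (foldr-commMonoid)
open import Algebra.Bundles using (CommutativeMonoid)
open import Relation.Binary.PropositionalEquality using (_≡_; refl; sym; trans; cong; cong₂; subst; module ≡-Reasoning)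

sumℤ-reverse : ∀ xs → sumℤ (reverse xs) ≡ sumℤ xs
sumℤ-reverse xs = foldr-commMonoid setoid isCommutativeMonoid (↭⇒↭ₛ (↭-reverse xs))
  where open CommutativeMonoid +-0-commutativeMonoid

bwd-fwd : ∀ x xs → bwd (fwd (x ∷ xs)) ≡ x ∷ xs
bwd-fwd x xs = begin
  bwdRev (reverse (xs ++ [ x + sumℤ xs ]))                 ≡⟨ cong bwdRev (reverse-++ xs _) ⟩
  (x + sumℤ xs - sumℤ (reverse xs)) ∷ reverse (reverse xs)
    ≡⟨ cong₂ (λ s ys → (x + sumℤ xs - s) ∷ ys) (sumℤ-reverse xs) (reverse-involutive xs) ⟩
  (x + sumℤ xs - sumℤ xs) ∷ xs                              ≡⟨ cong (_∷ xs) (//-rightDividesʳ (sumℤ xs) x) ⟩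
  x ∷ xs                                                    ∎
  where open ≡-Reasoning

module _ (α β : ℤ) where

  combine : ℤ → ℤ → ℤ
  combine a b = α * a + β * b

  data LinComb : List ℤ → List ℤ → List ℤ → Set where
    []  : LinComb [] [] []
    _∷_ : ∀ {a b c as bs cs} → c ≡ combine a b → LinComb as bs cs →
          LinComb (a ∷ as) (b ∷ bs) (c ∷ cs)

-- combine is unfolded here because the ring solver does not see through it.
combine-0 : ∀ α β → 0ℤ ≡ α * 0ℤ + β * 0ℤ
combine-0 = solve-∀

combine-+ : ∀ α β a b x y →
            (α * a + β * b) + (α * x + β * y) ≡ α * (a + x) + β * (b + y)
combine-+ = solve-∀

combine-- : ∀ α β a b x y →
            (α * a + β * b) - (α * x + β * y) ≡ α * (a - x) + β * (b - y)
combine-- = solve-∀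

module _ {α β : ℤ} where

  LinComb-∷ʳ : ∀ {a b c as bs cs} → LinComb α β as bs cs → c ≡ combine α β a b →
               LinComb α β (as ++ [ a ]) (bs ++ [ b ]) (cs ++ [ c ])
  LinComb-∷ʳ []         e′ = e′ ∷ []
  LinComb-∷ʳ (e ∷ abc) e′ = e ∷ LinComb-∷ʳ abc e′

  LinComb-sumℤ : ∀ {as bs cs} → LinComb α β as bs cs →
                 sumℤ cs ≡ combine α β (sumℤ as) (sumℤ bs)
  LinComb-sumℤ [] = combine-0 α β
  LinComb-sumℤ {a ∷ as} {b ∷ bs} (e ∷ abc) =
    trans (cong₂ _+_ e (LinComb-sumℤ abc)) (combine-+ α β a b (sumℤ as) (sumℤ bs))

  LinComb-reverse : ∀ {as bs cs} → LinComb α β as bs cs →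
                    LinComb α β (reverse as) (reverse bs) (reverse cs)
  LinComb-reverse [] = []
  LinComb-reverse {a ∷ as} {b ∷ bs} {c ∷ cs} (e ∷ abc)
    rewrite unfold-reverse a as | unfold-reverse b bs | unfold-reverse c cs =
    LinComb-∷ʳ (LinComb-reverse abc) e

  LinComb-fwd : ∀ {as bs cs} → LinComb α β as bs cs → LinComb α β (fwd as) (fwd bs) (fwd cs)
  LinComb-fwd []        = []
  LinComb-fwd (e ∷ abc) = LinComb-∷ʳ abc (LinComb-sumℤ (e ∷ abc))

  LinComb-bwdRev : ∀ {as bs cs} → LinComb α β as bs cs →
                   LinComb α β (bwdRev as) (bwdRev bs) (bwdRev cs)
  LinComb-bwdRev [] = []
  LinComb-bwdRev {a ∷ as} {b ∷ bs} (e ∷ abc) =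
    trans (cong₂ _-_ e (LinComb-sumℤ abc)) (combine-- α β a b (sumℤ as) (sumℤ bs))
    ∷ LinComb-reverse abc

  LinComb-bwd : ∀ {as bs cs} → LinComb α β as bs cs → LinComb α β (bwd as) (bwd bs) (bwd cs)
  LinComb-bwd abc = LinComb-bwdRev (LinComb-reverse abc)

  LinComb-lastℤ : ∀ {as bs cs} → LinComb α β as bs cs →
                  lastℤ cs ≡ combine α β (lastℤ as) (lastℤ bs)
  LinComb-lastℤ []                = combine-0 α β
  LinComb-lastℤ (e ∷ [])          = e
  LinComb-lastℤ (_ ∷ abc@(_ ∷ _)) = LinComb-lastℤ abc

module _ {α β x : ℤ} {xs v : List ℤ} (base : LinComb α β (fwd (x ∷ xs)) (x ∷ xs) v) where

  private
    u : List ℤ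
    u = x ∷ xs

  LinComb-iter-fwd : ∀ n → LinComb α β (iter fwd (suc n) u) (iter fwd n u) (iter fwd n v)
  LinComb-iter-fwd zero    = base
  LinComb-iter-fwd (suc n) = LinComb-fwd (LinComb-iter-fwd n)

  LinComb-iter-bwd : ∀ n → LinComb α β (iter bwd n u) (iter bwd (suc n) u) (iter bwd (suc n) v)
  LinComb-iter-bwd zero    =
    subst (λ w → LinComb α β w (bwd u) (bwd v)) (bwd-fwd x xs) (LinComb-bwd base)
  LinComb-iter-bwd (suc n) = LinComb-bwd (LinComb-iter-bwd n)

  LinComb-windowAt : ∀ j → LinComb α β (windowAt u (1ℤ + j)) (windowAt u j) (windowAt v j)
  -- 1ℤ + -[1+ n ] only computes once n is split.
  LinComb-windowAt (+ n)          = LinComb-iter-fwd n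
  LinComb-windowAt -[1+ zero ]    = LinComb-iter-bwd zero
  LinComb-windowAt -[1+ suc n ]   = LinComb-iter-bwd (suc n)

  seqAt-combine : ∀ m → seqAt v m ≡ combine α β (seqAt u (1ℤ + m)) (seqAt u m)
  seqAt-combine m = begin
    lastℤ (windowAt v (m - 1ℤ))
      ≡⟨ LinComb-lastℤ (LinComb-windowAt (m - 1ℤ)) ⟩
    combine α β (lastℤ (windowAt u (1ℤ + (m - 1ℤ)))) (seqAt u m)
      ≡⟨ cong (λ i → combine α β (lastℤ (windowAt u i)) (seqAt u m)) (sym (+-assoc 1ℤ m -1ℤ)) ⟩
    combine α β (seqAt u (1ℤ + m)) (seqAt u m) ∎
    where open ≡-Reasoning

sumℤ-fibInit : ∀ m → sumℤ (replicate m 0ℤ ++ [ 1ℤ ]) ≡ 1ℤ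
sumℤ-fibInit zero    = refl
sumℤ-fibInit (suc m) = cong (_+_ 0ℤ) (sumℤ-fibInit m)

lucasInit-LinComb : ∀ m → LinComb (+ 2) -1ℤ (fwd (fibInit (suc (suc m))))
                                             (fibInit (suc (suc m)))
                                             (lucasInit (suc (suc m)))
lucasInit-LinComb m rewrite sumℤ-fibInit m = go m
  where
    go : ∀ m → LinComb (+ 2) -1ℤ ((replicate m 0ℤ ++ [ 1ℤ ]) ++ [ 1ℤ ])
                                   (replicate (suc m) 0ℤ ++ [ 1ℤ ])
                                   (replicate m 0ℤ ++ (+ 2 ∷ 1ℤ ∷ []))
    go zero    = refl ∷ refl ∷ []
    go (suc m) = refl ∷ go m

L≡2F[1+n]-F : ∀ k → 2 ≤ k → ∀ n → L k n ≡ + 2 * F k (1ℤ + n) - F k n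
L≡2F[1+n]-F (suc (suc m)) (s≤s (s≤s _)) n =
  trans (seqAt-combine (lucasInit-LinComb m) n) (cong (_+_ (+ 2 * F k (1ℤ + n))) (-1*i≡-i (F k n)))
  where k = suc (suc m)

1-n≡-[n-1] : ∀ n → 1ℤ + - n ≡ - (n - 1ℤ)
1-n≡-[n-1] = solve-∀

lemma2p8 : (k : ℕ) → 2 ≤ k → (n : ℤ) → Q k n ≡ (+ 2) * H k (n - 1ℤ) - H k n
lemma2p8 k k≥2 n = begin
  L k (- n)                              ≡⟨ L≡2F[1+n]-F k k≥2 (- n) ⟩
  + 2 * F k (1ℤ + - n) - F k (- n)       ≡⟨ cong (λ i → + 2 * F k i - F k (- n)) (1-n≡-[n-1] n) ⟩
  + 2 * F k (- (n - 1ℤ)) - F k (- n)     ∎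
  where open ≡-Reasoning
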